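{- Let $\{T_\alpha \mid 1 \le \alpha < \omega_1\}$ be the family of trees constructed below, with any admissible choice of the functions $\psi_\beta$ at the limit stages, and regard each $T_\alpha$ as a free (unrooted) tree. Then for $1 \le \alpha < \beta < \omega_1$ the free trees $T_\alpha$ and $T_\beta$ are not topologically equivalent. Consequently the family contains $\omega_1$ many topological types of free locally finite trees.
   Context: For free (unrooted) graphs, $T$ is a topological minor of $U$ if some subdivision of $T$ is isomorphic to a subgraph of $U$. Two free trees are topologically equivalent (have the same topological type) if each is a topological minor of the other. "Attaching" a rooted tree to a vertex $v$ means joining $v$ by a new edge to the root of a fresh disjoint copy of that tree. The construction is by transfinite recursion on $1 \le \beta < \omega_1$; the trees are built as rooted trees: - $T_1$ is a ray $v_1 v_2 v_3 \ldots$ rooted at $v_1$. - If $\beta = \alpha + 1$, take a ray $R = v_1 v_2 \ldots$ rooted at $v_1$ and attach to each $v_i$ its own copy of $T_\alpha$. - If $\beta$ is a limit ordinal, choose any strictly increasing function $\psi_\beta : \omega \to \beta \setminus \{0\}$ with range cofinal in $\beta$. Take a ray $R = v_1 v_2 \ldots$ rooted at $v_1$ and attach to each $v_i$ its own copy of $T_{\psi_\beta(i)}$. -}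

module Defs where

open import Data.Nat using (ℕ; zero; suc; _<?_)
open import Data.Fin using (Fin; toℕ; fromℕ<)
open import Data.Sum using (_⊎_; inj₁; inj₂)
open import Data.Product using (Σ; _×_; _,_; ∃)
open import Relation.Nullary using (¬_; yes; no)
open import Relation.Binary.PropositionalEquality using (_≡_)
open import Function.Definitions using (Injective)

-- Countable ordinals ≥ 1 as Brouwer ordinal notations.
-- `one` denotes 1, `suc a` denotes a+1, `lim f` denotes sup of f.

data Ord : Set where
  one : Ord
  suc : Ord → Ord
  lim : (ℕ → Ord) → Ord

-- The standard (Kraus–Nordvall Forsberg–Xu) order on Brouwer trees.
data _≤ₒ_ : Ord → Ord → Set where
  ≤-one      : ∀ {x} → one ≤ₒ x
  ≤-trans    : ∀ {x y z} → x ≤ₒ y → y ≤ₒ z → x ≤ₒ z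
  ≤-suc-mono : ∀ {x y} → x ≤ₒ y → suc x ≤ₒ suc y
  ≤-cocone   : ∀ {x f} (k : ℕ) → x ≤ₒ f k → x ≤ₒ lim f
  ≤-limiting : ∀ {f x} → (∀ k → f k ≤ₒ x) → lim f ≤ₒ x

_<ₒ_ : Ord → Ord → Set
a <ₒ b = suc a ≤ₒ b

-- Admissible notations: at every limit stage the sequence ψ is
-- strictly increasing (its values are ≥ 1 automatically, and its
-- range is cofinal in the limit it denotes by construction).
data Admissible : Ord → Set where
  adm-one : Admissible one
  adm-suc : ∀ {a} → Admissible a → Admissible (suc a)
  adm-lim : ∀ {f} → (∀ i → Admissible (f i)) →
            (∀ i → f i <ₒ f (suc i)) → Admissible (lim f)

record Graph : Set₁ where
  field
    Vtx  : Set
    Edge : Set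
    src  : Edge → Vtx
    tgt  : Edge → Vtx

open Graph public

Adj : (G : Graph) → Vtx G → Vtx G → Set
Adj G x y = Σ (Edge G) λ e →
  ((src G e ≡ x) × (tgt G e ≡ y)) ⊎ ((src G e ≡ y) × (tgt G e ≡ x))

-- Subdivision of G in which edge e is replaced by a path with ℓ e
-- interior vertices (ℓ e + 1 edges).
module _ (G : Graph) (ℓ : Edge G → ℕ) where
  SubVtx : Set
  SubVtx = Vtx G ⊎ Σ (Edge G) (λ e → Fin (ℓ e))

  -- k-th vertex on the path replacing e (0 = src, ℓ e + 1 = tgt)
  point : Edge G → ℕ → SubVtx
  point e zero = inj₁ (src G e)
  point e (suc k) with k <? ℓ e
  ... | yes p = inj₂ (e , fromℕ< p)
  ... | no _  = inj₁ (tgt G e)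

  subdivide : Graph
  subdivide = record
    { Vtx  = SubVtx
    ; Edge = Σ (Edge G) (λ e → Fin (suc (ℓ e)))
    ; src  = λ { (e , j) → point e (toℕ j) }
    ; tgt  = λ { (e , j) → point e (suc (toℕ j)) }
    }

SubgraphEmb : Graph → Graph → Set
SubgraphEmb H U = Σ (Vtx H → Vtx U) λ φ →
  Injective _≡_ _≡_ φ × (∀ x y → Adj H x y → Adj U (φ x) (φ y))

TopMinor : Graph → Graph → Set
TopMinor T U = Σ (Edge T → ℕ) λ ℓ → SubgraphEmb (subdivide T ℓ) U

TopEquiv : Graph → Graph → Set
TopEquiv T U = TopMinor T U × TopMinor U T

-- The trees T_a.  Vertices: ray vertices v_i (ray i; root = ray 0) and
-- the vertices of the copy of the attached tree at v_i.

data V : Ord → Set where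
  ray  : ∀ {a} → ℕ → V a
  subS : ∀ {a} → ℕ → V a → V (suc a)
  subL : ∀ {f} (i : ℕ) → V (f i) → V (lim f)

data E : Ord → Set where
  rayE  : ∀ {a} → ℕ → E a                        -- v_i v_{i+1}
  hangS : ∀ {a} → ℕ → E (suc a)                  -- v_i to root of i-th copy
  inS   : ∀ {a} → ℕ → E a → E (suc a)
  hangL : ∀ {f} → ℕ → E (lim f)
  inL   : ∀ {f} (i : ℕ) → E (f i) → E (lim f)

srcE : ∀ {a} → E a → V a
tgtE : ∀ {a} → E a → V a
srcE (rayE i)  = ray i
srcE (hangS i) = ray i
srcE (inS i e) = subS i (srcE e)
srcE (hangL i) = ray i
srcE (inL i e) = subL i (srcE e)
tgtE (rayE i)  = ray (suc i)
tgtE (hangS i) = subS i (ray 0)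
tgtE (inS i e) = subS i (tgtE e)
tgtE (hangL i) = subL i (ray 0)
tgtE (inL i e) = subL i (tgtE e)

T : Ord → Graph
T a = record { Vtx = V a ; Edge = E a ; src = srcE ; tgt = tgtE }

-- A ray in T α eventually climbs the spine of some nested copy T ε, ε ≤ α: it
-- cannot run down the spine forever, and once inside a copy it can leave only
-- through the vertex where the copy is attached.  Suppose a subdivision of T γ
-- sits in T α with α < γ.  The image of the spine of T γ is such a ray, so for
-- large j the image of v_j lies on the climbing spine of T ε, with both spine
-- neighbours already used.  The branch hanging at v_j therefore enters the copy
-- of T (Child ε K) attached there and never leaves it, which embeds a
-- subdivision of T (Child γ j) into T (Child ε K).  As Child ε K < ε ≤ α ≤ Child γ j
-- for large j, induction on γ concludes.  The case analysis on rays is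
-- classical, so the ray lemma is stated under a double negation.
module Submission where

open import Defs
open import Data.Empty using (⊥; ⊥-elim)
open import Data.Unit using (⊤; tt)
open import Data.Nat using (ℕ; zero; suc; _+_; _≤_; _<_; z≤n; s≤s; _<?_)
open import Data.Nat.Properties
  using (+-identityʳ; +-suc; +-assoc; +-comm; +-cancelˡ-≡; suc-injective; 1+n≢0; ≤-refl;
         <⇒≤; <⇒≢; <-irrefl; <-≤-trans; ≤-antisym; ≮⇒≥; n<1+n; n≤1+n; m<n⇒m<1+n;
         m≤m+n; m≤n+m; m≤n⇒m≤1+n; m≤n⇒∃[o]m+o≡n)
  renaming (≤-trans to ≤ℕ-trans)
open import Data.Fin using (Fin; toℕ; fromℕ<)
open import Data.Fin.Properties using (toℕ-fromℕ<; fromℕ<-toℕ; toℕ<n)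
open import Data.Product using (Σ; _×_; _,_; proj₁; proj₂)
open import Data.Sum using (_⊎_; inj₁; inj₂)
import Data.Sum as Sum
open import Function using (_∘_)
open import Relation.Nullary using (¬_; Dec; yes; no)
open import Relation.Binary.PropositionalEquality
  using (_≡_; _≢_; refl; sym; trans; cong; subst; subst₂; module ≡-Reasoning)

-- _≤ₒ_ is only used through ≤ₒ⇒⊑: these structurally recursive versions of
-- the order on Brouwer trees can be taken apart by pattern matching.
mutual
  _⊑_ : Ord → Ord → Set
  one   ⊑ y = ⊤
  suc x ⊑ y = x ⊏ y
  lim f ⊑ y = ∀ k → f k ⊑ y

  _⊏_ : Ord → Ord → Set
  x ⊏ one   = ⊥
  x ⊏ suc y = x ⊑ y
  x ⊏ lim g = Σ ℕ λ k → x ⊏ g k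

⊑-cocone : ∀ x g k → x ⊑ g k → x ⊑ lim g
⊑-cocone one     g k p = tt
⊑-cocone (suc x) g k p = k , p
⊑-cocone (lim f) g k p = λ i → ⊑-cocone (f i) g k (p i)

⊑-refl : ∀ x → x ⊑ x
⊑-refl one     = tt
⊑-refl (suc x) = ⊑-refl x
⊑-refl (lim f) = λ k → ⊑-cocone (f k) f k (⊑-refl (f k))

mutual
  ⊑-trans : ∀ x y z → x ⊑ y → y ⊑ z → x ⊑ z
  ⊑-trans one     y z p q = tt
  ⊑-trans (suc x) y z p q = ⊏-⊑-trans x y z p q
  ⊑-trans (lim f) y z p q = λ k → ⊑-trans (f k) y z (p k) q

  ⊏-⊑-trans : ∀ x y z → x ⊏ y → y ⊑ z → x ⊏ z
  ⊏-⊑-trans x (suc y) z p       q = ⊑-⊏-trans x y z p q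
  ⊏-⊑-trans x (lim g) z (k , p) q = ⊏-⊑-trans x (g k) z p (q k)

  ⊑-⊏-trans : ∀ x y z → x ⊑ y → y ⊏ z → x ⊏ z
  ⊑-⊏-trans x y (suc z) p q       = ⊑-trans x y z p q
  ⊑-⊏-trans x y (lim h) p (k , q) = k , ⊑-⊏-trans x y (h k) p q

⊑-suc : ∀ x → x ⊑ suc x
⊑-suc one     = tt
⊑-suc (suc x) = ⊑-suc x
⊑-suc (lim f) = λ k → ⊑-trans (f k) (suc (f k)) (suc (lim f))
  (⊑-suc (f k)) (⊑-cocone (f k) f k (⊑-refl (f k)))

⊏⇒⊑ : ∀ x y → x ⊏ y → x ⊑ y
⊏⇒⊑ x (suc y) p       = ⊑-trans x y (suc y) p (⊑-suc y)
⊏⇒⊑ x (lim g) (k , p) = ⊑-cocone x g k (⊏⇒⊑ x (g k) p)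

≤ₒ⇒⊑ : ∀ {x y} → x ≤ₒ y → x ⊑ y
≤ₒ⇒⊑ ≤-one                          = tt
≤ₒ⇒⊑ (≤-trans {x} {y} {z} p q)      = ⊑-trans x y z (≤ₒ⇒⊑ p) (≤ₒ⇒⊑ q)
≤ₒ⇒⊑ (≤-suc-mono p)                 = ≤ₒ⇒⊑ p
≤ₒ⇒⊑ (≤-cocone {x} {f} k p)         = ⊑-cocone x f k (≤ₒ⇒⊑ p)
≤ₒ⇒⊑ (≤-limiting h)                 = λ k → ≤ₒ⇒⊑ (h k)

<ₒ⇒⊏ : ∀ {x y} → x <ₒ y → x ⊏ y
<ₒ⇒⊏ = ≤ₒ⇒⊑

Admissible-lim-mono : ∀ {g} → Admissible (lim g) → ∀ k d → g k ⊑ g (k + d)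
Admissible-lim-mono {g} _ k zero =
  subst (λ i → g k ⊑ g i) (sym (+-identityʳ k)) (⊑-refl (g k))
Admissible-lim-mono {g} ad@(adm-lim _ inc) k (suc d) =
  subst (λ i → g k ⊑ g i) (sym (+-suc k d))
    (⊑-trans (g k) (g (k + d)) (g (suc (k + d)))
      (Admissible-lim-mono ad k d) (⊏⇒⊑ (g (k + d)) _ (<ₒ⇒⊏ (inc (k + d)))))

-- For α ≠ 1, T α is the ray v₀ v₁ … with a copy of T (Child α m) attached
-- at v_m; NotOne α selects the successor or limit constructors of V α and E α.
data NotOne : Ord → Set where
  nsuc : ∀ {a} → NotOne (suc a)
  nlim : ∀ {f} → NotOne (lim f)

Child : Ord → ℕ → Ord
Child one     m = one
Child (suc a) m = a
Child (lim f) m = f m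

Child-⊏ : ∀ α → NotOne α → Admissible α → ∀ m → Child α m ⊏ α
Child-⊏ (suc a) nsuc _                m = ⊑-refl a
Child-⊏ (lim f) nlim (adm-lim _ inc)  m = suc m , <ₒ⇒⊏ (inc m)

Child-admissible : ∀ α → Admissible α → ∀ m → Admissible (Child α m)
Child-admissible one     ad              m = ad
Child-admissible (suc _) (adm-suc ad)    m = ad
Child-admissible (lim _) (adm-lim ads _) m = ads m

inCopy : ∀ {α} → NotOne α → (m : ℕ) → V (Child α m) → V α
inCopy nsuc = subS
inCopy nlim = subL

inCopyE : ∀ {α} → NotOne α → (m : ℕ) → E (Child α m) → E α
inCopyE nsuc = inS
inCopyE nlim = inL

hangE : ∀ {α} → NotOne α → ℕ → E α
hangE nsuc = hangS
hangE nlim = hangL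

src-inCopyE : ∀ {α} (nz : NotOne α) m e → srcE (inCopyE nz m e) ≡ inCopy nz m (srcE e)
src-inCopyE nsuc m e = refl
src-inCopyE nlim m e = refl

tgt-inCopyE : ∀ {α} (nz : NotOne α) m e → tgtE (inCopyE nz m e) ≡ inCopy nz m (tgtE e)
tgt-inCopyE nsuc m e = refl
tgt-inCopyE nlim m e = refl

src-hangE : ∀ {α} (nz : NotOne α) m → srcE (hangE {α} nz m) ≡ ray m
src-hangE nsuc m = refl
src-hangE nlim m = refl

tgt-hangE : ∀ {α} (nz : NotOne α) m → tgtE (hangE {α} nz m) ≡ inCopy nz m (ray 0)
tgt-hangE nsuc m = refl
tgt-hangE nlim m = refl

inCopy≢ray : ∀ {α} (nz : NotOne α) {m w c} → inCopy {α} nz m w ≢ ray c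
inCopy≢ray nsuc ()
inCopy≢ray nlim ()

inCopy-injective : ∀ {α} (nz : NotOne α) {m w w'} → inCopy {α} nz m w ≡ inCopy nz m w' → w ≡ w'
inCopy-injective nsuc refl = refl
inCopy-injective nlim refl = refl

ray-injective : ∀ {α m n} → ray {α} m ≡ ray n → m ≡ n
ray-injective refl = refl

ray-or-inCopy : ∀ {α} (x : V α) → (Σ ℕ λ c → x ≡ ray c) ⊎
  (Σ (NotOne α) λ nz → Σ ℕ λ m → Σ (V (Child α m)) λ w → x ≡ inCopy nz m w)
ray-or-inCopy (ray c)    = inj₁ (c , refl)
ray-or-inCopy (subS m w) = inj₂ (nsuc , m , w , refl)
ray-or-inCopy (subL m w) = inj₂ (nlim , m , w , refl)

ray-neighbours : ∀ {α} c z → Adj (T α) (ray c) z →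
  (z ≡ ray (suc c)) ⊎ (Σ ℕ λ c' → (c ≡ suc c') × (z ≡ ray c')) ⊎
  (Σ (NotOne α) λ nz → z ≡ inCopy nz c (ray 0))
ray-neighbours c z (rayE i  , inj₁ (refl , refl)) = inj₁ refl
ray-neighbours c z (rayE i  , inj₂ (refl , refl)) = inj₂ (inj₁ (i , refl , refl))
ray-neighbours c z (hangS i , inj₁ (refl , refl)) = inj₂ (inj₂ (nsuc , refl))
ray-neighbours c z (hangL i , inj₁ (refl , refl)) = inj₂ (inj₂ (nlim , refl))
ray-neighbours c z (hangS i , inj₂ (_ , ()))
ray-neighbours c z (hangL i , inj₂ (_ , ()))
ray-neighbours c z (inS i e , inj₁ (() , _))
ray-neighbours c z (inS i e , inj₂ (_ , ()))
ray-neighbours c z (inL i e , inj₁ (() , _))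
ray-neighbours c z (inL i e , inj₂ (_ , ()))

copy-neighbours : ∀ {α} (nz : NotOne α) m w z → Adj (T α) (inCopy nz m w) z →
  ((w ≡ ray 0) × (z ≡ ray m)) ⊎
  (Σ (V (Child α m)) λ w' → (z ≡ inCopy nz m w') × Adj (T (Child α m)) w w')
copy-neighbours nsuc m w z (hangS i , inj₂ (refl , refl)) = inj₁ (refl , refl)
copy-neighbours nsuc m w z (inS i e , inj₁ (refl , refl)) = inj₂ (tgtE e , refl , e , inj₁ (refl , refl))
copy-neighbours nsuc m w z (inS i e , inj₂ (refl , refl)) = inj₂ (srcE e , refl , e , inj₂ (refl , refl))
copy-neighbours nsuc m w z (rayE i  , inj₁ (() , _))
copy-neighbours nsuc m w z (rayE i  , inj₂ (_ , ()))
copy-neighbours nsuc m w z (hangS i , inj₁ (() , _))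
copy-neighbours nlim m w z (hangL i , inj₂ (refl , refl)) = inj₁ (refl , refl)
copy-neighbours nlim m w z (inL i e , inj₁ (refl , refl)) = inj₂ (tgtE e , refl , e , inj₁ (refl , refl))
copy-neighbours nlim m w z (inL i e , inj₂ (refl , refl)) = inj₂ (srcE e , refl , e , inj₂ (refl , refl))
copy-neighbours nlim m w z (rayE i  , inj₁ (() , _))
copy-neighbours nlim m w z (rayE i  , inj₂ (_ , ()))
copy-neighbours nlim m w z (hangL i , inj₁ (() , _))

Adj-inCopy⁻ : ∀ {α} (nz : NotOne α) m {w w'} →
  Adj (T α) (inCopy nz m w) (inCopy nz m w') → Adj (T (Child α m)) w w'
Adj-inCopy⁻ nz m {w} {w'} a with copy-neighbours nz m w (inCopy nz m w') a
... | inj₁ (_ , e)        = ⊥-elim (inCopy≢ray nz e)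
... | inj₂ (w″ , e , a') = subst (Adj _ w) (sym (inCopy-injective nz e)) a'

-- Address of a nested copy: `down nz m p` enters the copy attached at v_m.
data Addr : Ord → Set where
  here : ∀ {α} → Addr α
  down : ∀ {α} → NotOne α → (m : ℕ) → Addr (Child α m) → Addr α

ordAt : ∀ {α} → Addr α → Ord
ordAt {α} here       = α
ordAt (down _ _ p)   = ordAt p

inAddr : ∀ {α} (p : Addr α) → V (ordAt p) → V α
inAddr here          x = x
inAddr (down nz m p) x = inCopy nz m (inAddr p x)

inAddr≡ray : ∀ {α} (p : Addr α) {u n} → inAddr p u ≡ ray n → u ≡ ray n
inAddr≡ray here          e = e
inAddr≡ray (down nz m p) e = ⊥-elim (inCopy≢ray nz e)

Adj-inAddr⁻ : ∀ {α} (p : Addr α) {u u'} →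
  Adj (T α) (inAddr p u) (inAddr p u') → Adj (T (ordAt p)) u u'
Adj-inAddr⁻ here          a = a
Adj-inAddr⁻ (down nz m p) a = Adj-inAddr⁻ p (Adj-inCopy⁻ nz m a)

inAddr-neighbours : ∀ {α} (p : Addr α) u z → Adj (T α) (inAddr p u) z →
  (Σ (V (ordAt p)) λ u' → (z ≡ inAddr p u') × Adj (T (ordAt p)) u u') ⊎ (u ≡ ray 0)
inAddr-neighbours here u z a = inj₁ (z , refl , a)
inAddr-neighbours (down nz m p) u z a with copy-neighbours nz m (inAddr p u) z a
... | inj₁ (e , _) = inj₂ (inAddr≡ray p e)
... | inj₂ (w' , refl , b) with inAddr-neighbours p u w' b
...   | inj₁ (u' , refl , c) = inj₁ (u' , refl , c)
...   | inj₂ e               = inj₂ e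

ordAt-⊑ : ∀ {α} → Admissible α → (p : Addr α) → ordAt p ⊑ α
ordAt-⊑ {α} ad here          = ⊑-refl α
ordAt-⊑ {α} ad (down nz m p) =
  ⊑-trans (ordAt p) (Child α m) α (ordAt-⊑ (Child-admissible α ad m) p)
    (⊏⇒⊑ (Child α m) α (Child-⊏ α nz ad m))

ordAt-admissible : ∀ {α} → Admissible α → (p : Addr α) → Admissible (ordAt p)
ordAt-admissible ad here              = ad
ordAt-admissible {α} ad (down nz m p) = ordAt-admissible (Child-admissible α ad m) p

Adj-≡ˡ : ∀ G {x x' y} → x ≡ x' → Adj G x y → Adj G x' y
Adj-≡ˡ G refl a = a

record Ray (G : Graph) : Set where
  field
    at        : ℕ → Vtx G
    injective : ∀ {m n} → at m ≡ at n → m ≡ n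
    adjacent  : ∀ n → Adj G (at n) (at (suc n))

open Ray

Ray-map : ∀ {G H} → SubgraphEmb G H → Ray G → Ray H
Ray-map (φ , φ-inj , φ-adj) ρ = record
  { at        = φ ∘ at ρ
  ; injective = injective ρ ∘ φ-inj
  ; adjacent  = λ n → φ-adj _ _ (adjacent ρ n)
  }

Ray-drop : ∀ {G} → Ray G → ℕ → Ray G
Ray-drop {G} ρ s = record
  { at        = λ t → at ρ (s + t)
  ; injective = +-cancelˡ-≡ s _ _ ∘ injective ρ
  ; adjacent  = λ t → subst (Adj G (at ρ (s + t))) (cong (at ρ) (sym (+-suc s t))) (adjacent ρ (s + t))
  }

Ray-inCopy⁻ : ∀ {α} (nz : NotOne α) m (ρ : Ray (T α)) (w : ℕ → V (Child α m)) →
  (∀ t → at ρ t ≡ inCopy nz m (w t)) → Ray (T (Child α m))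
Ray-inCopy⁻ {α} nz m ρ w ρ≡w = record
  { at        = w
  ; injective = λ {a} {b} e → injective ρ (trans (ρ≡w a) (trans (cong (inCopy nz m) e) (sym (ρ≡w b))))
  ; adjacent  = λ t → Adj-inCopy⁻ nz m (subst₂ (Adj (T α)) (ρ≡w t) (ρ≡w (suc t)) (adjacent ρ t))
  }

ClimbsSpine : ∀ α → Ray (T α) → Set
ClimbsSpine α ρ = Σ (Addr α) λ p → Σ ℕ λ n₀ → Σ ℕ λ c →
  ∀ t → at ρ (n₀ + t) ≡ inAddr p (ray (c + t))

module RayInT (α : Ord)
  (ih : ∀ (nz : NotOne α) m (ρ : Ray (T (Child α m))) → ¬ ¬ ClimbsSpine (Child α m) ρ)
  (ρ : Ray (T α)) (¬climbs : ¬ ClimbsSpine α ρ) where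

  StaysInCopy : ℕ → NotOne α → ℕ → Set
  StaysInCopy s nz m = ∀ t → Σ (V (Child α m)) λ w → at ρ (s + t) ≡ inCopy nz m w

  ¬stays-in-copy : ∀ s nz m → ¬ StaysInCopy s nz m
  ¬stays-in-copy s nz m stays = ih nz m ρ' λ (p , n₀ , c , climb) →
    ¬climbs (down nz m p , s + n₀ , c , λ t → begin
      at ρ (s + n₀ + t)         ≡⟨ cong (at ρ) (+-assoc s n₀ t) ⟩
      at ρ (s + (n₀ + t))       ≡⟨ proj₂ (stays (n₀ + t)) ⟩
      inCopy nz m (at ρ' (n₀ + t)) ≡⟨ cong (inCopy nz m) (climb t) ⟩
      inAddr (down nz m p) (ray (c + t)) ∎)
    where
    open ≡-Reasoning
    ρ' : Ray (T (Child α m))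
    ρ' = Ray-inCopy⁻ nz m (Ray-drop ρ s) (proj₁ ∘ stays) (proj₂ ∘ stays)

  -- Leaving the copy attached at v_m means passing through v_m.
  stays-in-copy : ∀ s nz m w → at ρ s ≡ inCopy nz m w →
    (∀ t → at ρ (s + t) ≢ ray m) → StaysInCopy s nz m
  stays-in-copy s nz m w e avoid zero = w , trans (cong (at ρ) (+-identityʳ s)) e
  stays-in-copy s nz m w e avoid (suc t) with stays-in-copy s nz m w e avoid t
  ... | w' , e' with copy-neighbours nz m w' (at ρ (s + suc t))
                       (Adj-≡ˡ (T α) e' (adjacent (Ray-drop ρ s) t))
  ...   | inj₁ (_ , e″)      = ⊥-elim (avoid (suc t) e″)
  ...   | inj₂ (w″ , e″ , _) = w″ , e″

  ¬reenters : ∀ s r nz m w → at ρ s ≡ inCopy nz m w → at ρ r ≡ ray m → r < s → ⊥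
  ¬reenters s r nz m w e e-r r<s = ¬stays-in-copy s nz m
    (stays-in-copy s nz m w e λ t e' →
      <⇒≢ (<-≤-trans r<s (m≤m+n s t)) (injective ρ (trans e-r (sym e'))))

  ¬climbs-from : ∀ s c → at ρ s ≡ ray c → at ρ (suc s) ≡ ray (suc c) → ⊥
  ¬climbs-from s c e₀ e₁ = ¬climbs (here , s , c , λ t →
    subst₂ (λ a b → at ρ a ≡ ray b) (+-comm t s) (+-comm t c) (proj₁ (climbing t)))
    where
    climbing : ∀ t → at ρ (t + s) ≡ ray (t + c) × at ρ (suc t + s) ≡ ray (suc t + c)
    climbing zero = e₀ , e₁
    climbing (suc t) with climbing t
    ... | e , e' with ray-neighbours (suc t + c) (at ρ (suc (suc t) + s))
                        (Adj-≡ˡ (T α) e' (adjacent ρ (suc t + s)))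
    ...   | inj₁ up = e' , up
    ...   | inj₂ (inj₁ (_ , refl , back)) =
      ⊥-elim (<⇒≢ (m<n⇒m<1+n (n<1+n (t + s))) (sym (injective ρ (trans back (sym e)))))
    ...   | inj₂ (inj₂ (nz , into)) =
      ⊥-elim (¬reenters (suc (suc t) + s) (suc t + s) nz (suc t + c) (ray 0) into e' (n<1+n _))

  ¬on-spine : ∀ c s → at ρ s ≡ ray c → ⊥
  ¬on-spine c s e with ray-neighbours c (at ρ (suc s)) (Adj-≡ˡ (T α) e (adjacent ρ s))
  ¬on-spine c s e | inj₁ up = ¬climbs-from s c e up
  ¬on-spine .(suc c') s e | inj₂ (inj₁ (c' , refl , back)) = ¬on-spine c' (suc s) back
  ¬on-spine c s e | inj₂ (inj₂ (nz , into)) = ¬reenters (suc s) s nz c (ray 0) into e (n<1+n s)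

  absurd : ⊥
  absurd with ray-or-inCopy (at ρ 0)
  ... | inj₁ (c , e)           = ¬on-spine c 0 e
  ... | inj₂ (nz , m , w , e) = ¬stays-in-copy 0 nz m (stays-in-copy 0 nz m w e (¬on-spine m))

ray-climbs-spine : ∀ α (ρ : Ray (T α)) → ¬ ¬ ClimbsSpine α ρ
ray-climbs-spine one     = RayInT.absurd one (λ ())
ray-climbs-spine (suc a) = RayInT.absurd (suc a) (λ { nsuc _ → ray-climbs-spine a })
ray-climbs-spine (lim f) = RayInT.absurd (lim f) (λ { nlim m → ray-climbs-spine (f m) })

module Subdivision (G : Graph) (ℓ : Edge G → ℕ) where

  point-adj : ∀ e k → k ≤ ℓ e → Adj (subdivide G ℓ) (point G ℓ e k) (point G ℓ e (suc k))
  point-adj e k k≤ℓ = (e , fromℕ< (s≤s k≤ℓ)) , inj₁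
    ( cong (point G ℓ e) (toℕ-fromℕ< (s≤s k≤ℓ))
    , cong (point G ℓ e ∘ suc) (toℕ-fromℕ< (s≤s k≤ℓ)) )

  point-end : ∀ e → point G ℓ e (suc (ℓ e)) ≡ inj₁ (tgt G e)
  point-end e with ℓ e <? ℓ e
  ... | yes ℓ<ℓ = ⊥-elim (<-irrefl refl ℓ<ℓ)
  ... | no _    = refl

  point-inner : ∀ e (f : Fin (ℓ e)) → point G ℓ e (suc (toℕ f)) ≡ inj₂ (e , f)
  point-inner e f with toℕ f <? ℓ e
  ... | yes f<ℓ = cong (λ f' → inj₂ (e , f')) (fromℕ<-toℕ f f<ℓ)
  ... | no f≮ℓ  = ⊥-elim (f≮ℓ (toℕ<n f))

  Closed : (SubVtx G ℓ → Set) → Set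
  Closed P = ∀ x y → Adj (subdivide G ℓ) x y → P x → P y

  module _ {P : SubVtx G ℓ → Set} (closed : Closed P) where

    Closed-along : ∀ e → P (inj₁ (src G e)) → ∀ k → k ≤ suc (ℓ e) → P (point G ℓ e k)
    Closed-along e p zero    _          = p
    Closed-along e p (suc k) (s≤s k≤ℓ) =
      closed _ _ (point-adj e k k≤ℓ) (Closed-along e p k (m≤n⇒m≤1+n k≤ℓ))

    Closed-tgt : ∀ e → P (inj₁ (src G e)) → P (inj₁ (tgt G e))
    Closed-tgt e p = subst P (point-end e) (Closed-along e p (suc (ℓ e)) ≤-refl)

    Closed-inner : ∀ e f → P (inj₁ (src G e)) → P (inj₂ (e , f))
    Closed-inner e f p =
      subst P (point-inner e f) (Closed-along e p (suc (toℕ f)) (s≤s (<⇒≤ (toℕ<n f))))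

module SubdivisionMap {G H : Graph} (g : Vtx H → Vtx G) (h : Edge H → Edge G)
  (src-h : ∀ e → src G (h e) ≡ g (src H e)) (tgt-h : ∀ e → tgt G (h e) ≡ g (tgt H e))
  (ℓ : Edge G → ℕ) where

  mapSub : SubVtx H (ℓ ∘ h) → SubVtx G ℓ
  mapSub (inj₁ v)       = inj₁ (g v)
  mapSub (inj₂ (e , f)) = inj₂ (h e , f)

  point-mapSub : ∀ e k → point G ℓ (h e) k ≡ mapSub (point H (ℓ ∘ h) e k)
  point-mapSub e zero = cong inj₁ (src-h e)
  point-mapSub e (suc k) with k <? ℓ (h e)
  ... | yes _ = refl
  ... | no _  = cong inj₁ (tgt-h e)

  Adj-mapSub : ∀ x y → Adj (subdivide H (ℓ ∘ h)) x y → Adj (subdivide G ℓ) (mapSub x) (mapSub y)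
  Adj-mapSub x y ((e , f) , ends) = (h e , f) , Sum.map mapEnds mapEnds ends
    where
    mapEnds : ∀ {a b} →
      (point H (ℓ ∘ h) e (toℕ f) ≡ a) × (point H (ℓ ∘ h) e (suc (toℕ f)) ≡ b) →
      (point G ℓ (h e) (toℕ f) ≡ mapSub a) × (point G ℓ (h e) (suc (toℕ f)) ≡ mapSub b)
    mapEnds (p , q) = trans (point-mapSub e (toℕ f)) (cong mapSub p)
                    , trans (point-mapSub e (suc (toℕ f))) (cong mapSub q)

module _ {γ : Ord} (nz : NotOne γ) (j : ℕ) (ℓ : E γ → ℕ) where
  open SubdivisionMap {T γ} {T (Child γ j)} (inCopy nz j) (inCopyE nz j)
    (src-inCopyE nz j) (tgt-inCopyE nz j) ℓ

  inCopySub : SubVtx (T (Child γ j)) (ℓ ∘ inCopyE nz j) → SubVtx (T γ) ℓ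
  inCopySub = mapSub

  Adj-inCopySub : ∀ x y → Adj (subdivide (T (Child γ j)) (ℓ ∘ inCopyE nz j)) x y →
    Adj (subdivide (T γ) ℓ) (inCopySub x) (inCopySub y)
  Adj-inCopySub = Adj-mapSub

inCopySub-injective : ∀ {γ} (nz : NotOne γ) j ℓ {x y} →
  inCopySub nz j ℓ x ≡ inCopySub nz j ℓ y → x ≡ y
inCopySub-injective nsuc j ℓ {inj₁ _} {inj₁ _} refl = refl
inCopySub-injective nsuc j ℓ {inj₂ _} {inj₂ _} refl = refl
inCopySub-injective nlim j ℓ {inj₁ _} {inj₁ _} refl = refl
inCopySub-injective nlim j ℓ {inj₂ _} {inj₂ _} refl = refl

module _ {δ : Ord} (ℓ : E δ → ℕ) {P : SubVtx (T δ) ℓ → Set}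
  (closed : Subdivision.Closed (T δ) ℓ P) where
  open Subdivision (T δ) ℓ

  Closed-ray : P (inj₁ (ray 0)) → ∀ n → P (inj₁ (ray n))
  Closed-ray root zero    = root
  Closed-ray root (suc n) = Closed-tgt closed (rayE n) (Closed-ray root n)

  Closed-inCopySub : (nz : NotOne δ) → ∀ m →
    Subdivision.Closed (T (Child δ m)) (ℓ ∘ inCopyE nz m) (P ∘ inCopySub nz m ℓ)
  Closed-inCopySub nz m x y a = closed _ _ (Adj-inCopySub nz m ℓ x y a)

  Closed-copy-root : (nz : NotOne δ) → P (inj₁ (ray 0)) → ∀ m → P (inCopySub nz m ℓ (inj₁ (ray 0)))
  Closed-copy-root nz root m =
    subst (P ∘ inj₁) (tgt-hangE nz m) (Closed-tgt closed (hangE nz m)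
      (subst (P ∘ inj₁) (sym (src-hangE nz m)) (Closed-ray root m)))

T-connected-Vtx : ∀ δ (ℓ : E δ → ℕ) {P : SubVtx (T δ) ℓ → Set} →
  Subdivision.Closed (T δ) ℓ P →
  P (inj₁ (ray 0)) → ∀ v → P (inj₁ v)
T-connected-Vtx δ ℓ closed root (ray n) = Closed-ray ℓ closed root n
T-connected-Vtx (suc a) ℓ closed root (subS m w) =
  T-connected-Vtx a (ℓ ∘ inS m) (Closed-inCopySub ℓ closed nsuc m)
    (Closed-copy-root ℓ closed nsuc root m) w
T-connected-Vtx (lim f) ℓ closed root (subL m w) =
  T-connected-Vtx (f m) (ℓ ∘ inL m) (Closed-inCopySub ℓ closed nlim m)
    (Closed-copy-root ℓ closed nlim root m) w

T-connected : ∀ δ (ℓ : E δ → ℕ) {P : SubVtx (T δ) ℓ → Set} →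
  Subdivision.Closed (T δ) ℓ P →
  P (inj₁ (ray 0)) → ∀ x → P x
T-connected δ ℓ closed root (inj₁ v) = T-connected-Vtx δ ℓ closed root v
T-connected δ ℓ closed root (inj₂ (e , f)) =
  Subdivision.Closed-inner (T δ) ℓ closed e f (T-connected-Vtx δ ℓ closed root (srcE e))

OnSpine : ∀ {γ ℓ} → SubVtx (T γ) ℓ → Set
OnSpine (inj₁ (ray _))       = ⊤
OnSpine (inj₁ _)             = ⊥
OnSpine (inj₂ (rayE _ , _))  = ⊤
OnSpine (inj₂ _)             = ⊥

hang-¬OnSpine : ∀ {γ ℓ} (nz : NotOne γ) j k →
  ¬ OnSpine {γ} {ℓ} (point (T γ) ℓ (hangE nz j) (suc k))
hang-¬OnSpine {ℓ = ℓ} nsuc j k with k <? ℓ (hangS j)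
... | yes _ = λ ()
... | no _  = λ ()
hang-¬OnSpine {ℓ = ℓ} nlim j k with k <? ℓ (hangL j)
... | yes _ = λ ()
... | no _  = λ ()

inCopySub-¬OnSpine : ∀ {γ} (nz : NotOne γ) j ℓ x → ¬ OnSpine {γ} {ℓ} (inCopySub nz j ℓ x)
inCopySub-¬OnSpine nsuc j ℓ (inj₁ _) ()
inCopySub-¬OnSpine nsuc j ℓ (inj₂ _) ()
inCopySub-¬OnSpine nlim j ℓ (inj₁ _) ()
inCopySub-¬OnSpine nlim j ℓ (inj₂ _) ()

-- The stop (i , k) is the k-th point of the subdivided edge v_i v_{i+1}.
module Spine (γ : Ord) (ℓ : E γ → ℕ) where
  open Subdivision (T γ) ℓ

  L : ℕ → ℕ
  L i = ℓ (rayE i)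

  next : ℕ × ℕ → ℕ × ℕ
  next (i , k) with k <? L i
  ... | yes _ = i , suc k
  ... | no _  = suc i , 0

  next-< : ∀ {i k} → k < L i → next (i , k) ≡ (i , suc k)
  next-< {i} {k} k<L with k <? L i
  ... | yes _  = refl
  ... | no k≮L = ⊥-elim (k≮L k<L)

  next-≮ : ∀ {i k} → ¬ k < L i → next (i , k) ≡ (suc i , 0)
  next-≮ {i} {k} k≮L with k <? L i
  ... | yes k<L = ⊥-elim (k≮L k<L)
  ... | no _    = refl

  stop : ℕ → ℕ × ℕ
  stop zero    = 0 , 0
  stop (suc n) = next (stop n)

  Valid : ℕ × ℕ → Set
  Valid (i , k) = k ≤ L i

  next-valid : ∀ s → Valid s → Valid (next s)
  next-valid (i , k) _ with k <? L i
  ... | yes k<L = k<L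
  ... | no _    = z≤n

  stop-valid : ∀ n → Valid (stop n)
  stop-valid zero    = z≤n
  stop-valid (suc n) = next-valid (stop n) (stop-valid n)

  -- index i is the number of stops before v_i
  index : ℕ → ℕ
  index zero    = 0
  index (suc i) = index i + suc (L i)

  mutual
    stop-index+ : ∀ i k → k ≤ L i → stop (index i + k) ≡ (i , k)
    stop-index+ i zero    _   = trans (cong stop (+-identityʳ (index i))) (stop-index i)
    stop-index+ i (suc k) k<L = begin
      stop (index i + suc k)    ≡⟨ cong stop (+-suc (index i) k) ⟩
      next (stop (index i + k)) ≡⟨ cong next (stop-index+ i k (<⇒≤ k<L)) ⟩
      next (i , k)              ≡⟨ next-< k<L ⟩
      (i , suc k)               ∎
      where open ≡-Reasoning

    stop-index : ∀ i → stop (index i) ≡ (i , 0)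
    stop-index zero    = refl
    stop-index (suc i) = begin
      stop (index i + suc (L i))    ≡⟨ cong stop (+-suc (index i) (L i)) ⟩
      next (stop (index i + L i))   ≡⟨ cong next (stop-index+ i (L i) ≤-refl) ⟩
      next (i , L i)                ≡⟨ next-≮ (<-irrefl refl) ⟩
      (suc i , 0)                   ∎
      where open ≡-Reasoning

  index-≥ : ∀ i → i ≤ index i
  index-≥ zero    = z≤n
  index-≥ (suc i) = ≤ℕ-trans (s≤s (index-≥ i))
    (subst (suc (index i) ≤_) (sym (+-suc (index i) (L i))) (s≤s (m≤m+n (index i) (L i))))

  code : ℕ × ℕ → ℕ
  code (i , k) = index i + k

  code-next : ∀ s → Valid s → code (next s) ≡ suc (code s)
  code-next (i , k) k≤L with k <? L i
  ... | yes _   = +-suc (index i) k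
  ... | no k≮L  = begin
    index i + suc (L i) + 0 ≡⟨ +-identityʳ _ ⟩
    index i + suc (L i)     ≡⟨ cong (λ x → index i + suc x) (≤-antisym (≮⇒≥ k≮L) k≤L) ⟩
    index i + suc k         ≡⟨ +-suc (index i) k ⟩
    suc (index i + k)       ∎
    where open ≡-Reasoning

  code-stop : ∀ n → code (stop n) ≡ n
  code-stop zero    = refl
  code-stop (suc n) = trans (code-next (stop n) (stop-valid n)) (cong suc (code-stop n))

  stopPoint : ℕ × ℕ → SubVtx (T γ) ℓ
  stopPoint (i , k) = point (T γ) ℓ (rayE i) k

  stopPoint-next : ∀ s → Valid s →
    stopPoint (next s) ≡ point (T γ) ℓ (rayE (proj₁ s)) (suc (proj₂ s))
  stopPoint-next (i , k) k≤L = by-cases (k <? L i)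
    where
    by-cases : Dec (k < L i) → stopPoint (next (i , k)) ≡ point (T γ) ℓ (rayE i) (suc k)
    by-cases (yes k<L) = cong stopPoint (next-< k<L)
    by-cases (no k≮L)  = begin
      stopPoint (next (i , k))         ≡⟨ cong stopPoint (next-≮ k≮L) ⟩
      inj₁ (ray (suc i))               ≡⟨ sym (point-end (rayE i)) ⟩
      point (T γ) ℓ (rayE i) (suc (L i))
        ≡⟨ cong (point (T γ) ℓ (rayE i) ∘ suc) (≤-antisym (≮⇒≥ k≮L) k≤L) ⟩
      point (T γ) ℓ (rayE i) (suc k)   ∎
      where open ≡-Reasoning

  decode : SubVtx (T γ) ℓ → ℕ × ℕ
  decode (inj₁ (ray i))          = i , 0
  decode (inj₂ (rayE i , f))     = i , suc (toℕ f)
  decode _                       = 0 , 0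

  decode-stopPoint : ∀ s → Valid s → decode (stopPoint s) ≡ s
  decode-stopPoint (i , zero)  _   = refl
  decode-stopPoint (i , suc k) k<L with k <? L i
  ... | yes _  = cong (λ x → i , suc x) (toℕ-fromℕ< _)
  ... | no k≮L = ⊥-elim (k≮L k<L)

  stopPoint-OnSpine : ∀ s → OnSpine (stopPoint s)
  stopPoint-OnSpine (i , zero)  = tt
  stopPoint-OnSpine (i , suc k) with k <? L i
  ... | yes _ = tt
  ... | no _  = tt

  stop-injective : ∀ {m n} → stopPoint (stop m) ≡ stopPoint (stop n) → m ≡ n
  stop-injective {m} {n} e = begin
    m                                ≡⟨ sym (code-stop m) ⟩
    code (stop m)                    ≡⟨ cong code (sym (decode-stopPoint _ (stop-valid m))) ⟩
    code (decode (stopPoint (stop m))) ≡⟨ cong (code ∘ decode) e ⟩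
    code (decode (stopPoint (stop n))) ≡⟨ cong code (decode-stopPoint _ (stop-valid n)) ⟩
    code (stop n)                    ≡⟨ code-stop n ⟩
    n                                ∎
    where open ≡-Reasoning

  spine : Ray (subdivide (T γ) ℓ)
  spine = record
    { at        = stopPoint ∘ stop
    ; injective = stop-injective
    ; adjacent  = λ n → subst (Adj (subdivide (T γ) ℓ) (stopPoint (stop n)))
                            (sym (stopPoint-next (stop n) (stop-valid n)))
                            (point-adj (rayE _) _ (stop-valid n))
    }

  spine-index : ∀ i → at spine (index i) ≡ inj₁ (ray i)
  spine-index i = cong stopPoint (stop-index i)

  spine-OnSpine : ∀ n → OnSpine (at spine n)
  spine-OnSpine n = stopPoint-OnSpine (stop n)

module DescendMinor {γ α : Ord} (nzγ : NotOne γ) (admα : Admissible α) (ℓ : E γ → ℕ)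
  (φ : SubVtx (T γ) ℓ → V α) (φ-inj : ∀ {x y} → φ x ≡ φ y → x ≡ y)
  (φ-adj : ∀ x y → Adj (subdivide (T γ) ℓ) x y → Adj (T α) (φ x) (φ y)) (N : ℕ) where
  open Spine γ ℓ
  open Subdivision (T γ) ℓ

  ρ : Ray (T α)
  ρ = Ray-map (φ , φ-inj , φ-adj) spine

  module Climbing (p : Addr α) (n₀ c : ℕ)
    (climb : ∀ t → at ρ (n₀ + t) ≡ inAddr p (ray (c + t))) where

    ε : Ord
    ε = ordAt p

    j : ℕ
    j = N + suc n₀

    -- v_j lies on the climbing part of ρ, at height K ≠ 0 in the copy T ε.
    n₀<index-j : suc n₀ ≤ index j
    n₀<index-j = ≤ℕ-trans (m≤n+m (suc n₀) N) (index-≥ j)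

    t₀ : ℕ
    t₀ = proj₁ (m≤n⇒∃[o]m+o≡n n₀<index-j)

    index-j : n₀ + suc t₀ ≡ index j
    index-j = trans (+-suc n₀ t₀) (proj₂ (m≤n⇒∃[o]m+o≡n n₀<index-j))

    K : ℕ
    K = c + suc t₀

    φ-vj : φ (inj₁ (ray j)) ≡ inAddr p (ray K)
    φ-vj = begin
      φ (inj₁ (ray j))            ≡⟨ cong φ (sym (spine-index j)) ⟩
      at ρ (index j)              ≡⟨ cong (at ρ) (sym index-j) ⟩
      at ρ (n₀ + suc t₀)          ≡⟨ climb (suc t₀) ⟩
      inAddr p (ray K)            ∎
      where open ≡-Reasoning

    climbing-OnSpine : ∀ t x → φ x ≡ inAddr p (ray (c + t)) → OnSpine x
    climbing-OnSpine t x e =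
      subst OnSpine (sym (φ-inj (trans e (sym (climb t))))) (spine-OnSpine (n₀ + t))

    hangPoint : ℕ → SubVtx (T γ) ℓ
    hangPoint = point (T γ) ℓ (hangE nzγ j)

    InCopyK : NotOne ε → SubVtx (T γ) ℓ → Set
    InCopyK nzε x = Σ (V (Child ε K)) λ w → φ x ≡ inAddr p (inCopy nzε K w)

    vj-x₁ : Adj (T α) (inAddr p (ray K)) (φ (hangPoint 1))
    vj-x₁ = Adj-≡ˡ (T α) (trans (cong (φ ∘ inj₁) (src-hangE nzγ j)) φ-vj)
                         (φ-adj _ _ (point-adj (hangE nzγ j) 0 z≤n))

    x₁-off-climb : ∀ t {u} → φ (hangPoint 1) ≡ inAddr p u → u ≡ ray (c + t) → ⊥
    x₁-off-climb t e u≡ = hang-¬OnSpine nzγ j 0 (climbing-OnSpine t _ (trans e (cong (inAddr p) u≡)))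

    -- The spine neighbours of φ v_j are images of the spine, so the branch
    -- at v_j must start into the copy attached at φ v_j.
    enters-copy : Σ (NotOne ε) λ nzε → InCopyK nzε (hangPoint 1)
    enters-copy with inAddr-neighbours p (ray K) (φ (hangPoint 1)) vj-x₁
    ... | inj₂ K≡0 = ⊥-elim (1+n≢0 (trans (sym (+-suc c t₀)) (ray-injective K≡0)))
    ... | inj₁ (u , e , a) with ray-neighbours K u a
    ...   | inj₁ up =
      ⊥-elim (x₁-off-climb (suc (suc t₀)) e (trans up (cong ray (sym (+-suc c (suc t₀))))))
    ...   | inj₂ (inj₁ (_ , K≡ , back)) =
      ⊥-elim (x₁-off-climb t₀ e (trans back (cong ray (suc-injective (trans (sym K≡) (+-suc c t₀))))))
    ...   | inj₂ (inj₂ (nzε , into)) = nzε , ray 0 , trans e (cong (inAddr p) into)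

    module Branch (nzε : NotOne ε) (start : InCopyK nzε (hangPoint 1)) where

      -- The copy can only be left through φ v_j, which lies on the spine.
      stays : ∀ x y → Adj (subdivide (T γ) ℓ) x y → ¬ OnSpine y → InCopyK nzε x → InCopyK nzε y
      stays x y a y∉ (w , e)
        with inAddr-neighbours p (inCopy nzε K w) (φ y) (Adj-≡ˡ (T α) e (φ-adj x y a))
      ... | inj₂ w≡0 = ⊥-elim (inCopy≢ray nzε w≡0)
      ... | inj₁ (u , e' , a') with copy-neighbours nzε K w u a'
      ...   | inj₁ (_ , u≡) = ⊥-elim (y∉ (climbing-OnSpine (suc t₀) y (trans e' (cong (inAddr p) u≡))))
      ...   | inj₂ (w' , u≡ , _) = w' , trans e' (cong (inAddr p) u≡)

      along-hang : ∀ k → k ≤ ℓ (hangE nzγ j) → InCopyK nzε (hangPoint (suc k))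
      along-hang zero    _    = start
      along-hang (suc k) k<ℓ = stays _ _ (point-adj (hangE nzγ j) (suc k) k<ℓ) (hang-¬OnSpine nzγ j (suc k))
        (along-hang k (≤ℕ-trans (n≤1+n k) k<ℓ))

      copy-root : InCopyK nzε (inj₁ (inCopy nzγ j (ray 0)))
      copy-root = subst (InCopyK nzε)
        (trans (point-end (hangE nzγ j)) (cong inj₁ (tgt-hangE nzγ j)))
        (along-hang (ℓ (hangE nzγ j)) ≤-refl)

      in-copy : ∀ x → InCopyK nzε (inCopySub nzγ j ℓ x)
      in-copy = T-connected (Child γ j) (ℓ ∘ inCopyE nzγ j)
        (λ x y a → stays _ _ (Adj-inCopySub nzγ j ℓ x y a) (inCopySub-¬OnSpine nzγ j ℓ y))
        copy-root

      ψ : SubVtx (T (Child γ j)) (ℓ ∘ inCopyE nzγ j) → V (Child ε K)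
      ψ = proj₁ ∘ in-copy

      minor : TopMinor (T (Child γ j)) (T (Child ε K))
      minor = ℓ ∘ inCopyE nzγ j , ψ
        , (λ {x} {y} e → inCopySub-injective nzγ j ℓ (φ-inj (trans (proj₂ (in-copy x))
             (trans (cong (inAddr p ∘ inCopy nzε K) e) (sym (proj₂ (in-copy y)))))))
        , λ x y a → Adj-inCopy⁻ nzε K (Adj-inAddr⁻ p
             (subst₂ (Adj (T α)) (proj₂ (in-copy x)) (proj₂ (in-copy y))
               (φ-adj _ _ (Adj-inCopySub nzγ j ℓ x y a))))

    descended : Σ ℕ λ d → Σ Ord λ β →
      Admissible β × β ⊏ α × TopMinor (T (Child γ (N + d))) (T β)
    descended with enters-copy
    ... | nzε , start = suc n₀ , Child ε K , Child-admissible ε admε K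
                      , ⊏-⊑-trans (Child ε K) ε α (Child-⊏ ε nzε admε K) (ordAt-⊑ admα p)
                      , Branch.minor nzε start
      where
      admε : Admissible ε
      admε = ordAt-admissible admα p

descend-minor : ∀ {γ α} → NotOne γ → Admissible α → TopMinor (T γ) (T α) → ∀ N →
  ¬ ¬ (Σ ℕ λ d → Σ Ord λ β → Admissible β × β ⊏ α × TopMinor (T (Child γ (N + d))) (T β))
descend-minor nzγ admα (ℓ , φ , φ-inj , φ-adj) N ¬descended =
  ray-climbs-spine _ ρ λ (p , n₀ , c , climb) → ¬descended (Climbing.descended p n₀ c climb)
  where open DescendMinor nzγ admα ℓ φ φ-inj φ-adj N

no-minor-of-smaller : ∀ γ → Admissible γ → ∀ α → Admissible α → α ⊏ γ →
  ¬ TopMinor (T γ) (T α)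
no-minor-of-smaller (suc a) (adm-suc adm-a) α admα α⊑a minor =
  descend-minor nsuc admα minor 0 λ (d , β , admβ , β⊏α , minor') →
    no-minor-of-smaller a adm-a β admβ (⊏-⊑-trans β α a β⊏α α⊑a) minor'
no-minor-of-smaller (lim g) adm-g@(adm-lim adm-gs _) α admα (k , α⊏gk) minor =
  descend-minor nlim admα minor k λ (d , β , admβ , β⊏α , minor') →
    no-minor-of-smaller (g (k + d)) (adm-gs (k + d)) β admβ
      (⊑-⊏-trans β α (g (k + d)) (⊏⇒⊑ β α β⊏α)
        (⊏-⊑-trans α (g k) (g (k + d)) α⊏gk (Admissible-lim-mono adm-g k d)))
      minor'

corollary1 : (a b : Ord) → Admissible a → Admissible b → a <ₒ b →
    ¬ TopEquiv (T a) (T b)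
corollary1 a b adm-a adm-b a<b (_ , b≼a) = no-minor-of-smaller b adm-b a adm-a (<ₒ⇒⊏ a<b) b≼a
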